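{- For every $q,k\in\mathbb{N}$ there exists $\zeta>0$ such that for every $m\in\mathbb{N}$ and $h>\ell\in\mathbb{N}$, \[|\mathcal{U}_q^{m,k}(h,\ell)|\le\Big(\frac{\zeta m}{\ell}\Big)^{\ell}.\]
   Context: For $U\in\mathbb{Z}_q^{m\times k}$, $\mathrm{wt}(U)$ is the number of nonzero entries and $\mathrm{rwt}(U)$ the number of nonzero rows. $\mathcal{U}_q^{m,k}(h,\ell)$ is the set of $U\in\mathbb{Z}_q^{m\times k}$ with $\mathrm{wt}(U)=h$, $\mathrm{rwt}(U)=\ell$, and no row having exactly one nonzero entry. -}

module Defs where

open import Data.Nat using (ℕ; zero; suc; _+_; _≟_)
open import Data.Fin using (Fin; toℕ)
open import Data.Vec using (Vec; []; _∷_)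
open import Data.List using (List; [_]; map; concatMap; allFin; filter; length)
import Data.Product
open Data.Product using (_×_)
open import Relation.Nullary using (Dec; yes; no; ¬_)
open import Relation.Binary.PropositionalEquality using (_≡_)
open import Data.Vec.Relation.Unary.All using (All)

-- Z_q is modelled as Fin q (residues 0,…,q-1); an entry is nonzero iff its value is not 0.
-- A matrix U ∈ Z_q^{m×k} is a vector of m rows, each a vector of k entries.
Matrix : ℕ → ℕ → ℕ → Set
Matrix q m k = Vec (Vec (Fin q) k) m

nz : ∀ {q k} → Vec (Fin q) k → ℕ
nz [] = 0
nz (x ∷ xs) with toℕ x ≟ 0
... | yes _ = nz xs
... | no _  = suc (nz xs)

wt : ∀ {q m k} → Matrix q m k → ℕ
wt [] = 0
wt (r ∷ rs) = nz r + wt rs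

rwt : ∀ {q m k} → Matrix q m k → ℕ
rwt [] = 0
rwt (r ∷ rs) with nz r ≟ 0
... | yes _ = rwt rs
... | no _  = suc (rwt rs)

InU : (q m k h ℓ : ℕ) → Matrix q m k → Set
InU q m k h ℓ U = wt U ≡ h × rwt U ≡ ℓ × All (λ r → ¬ (nz r ≡ 1)) U

private
  all? : ∀ {q m k} (U : Matrix q m k) → Dec (All (λ r → ¬ (nz r ≡ 1)) U)
  all? [] = yes All.[]
  all? (r ∷ rs) with nz r ≟ 1 | all? rs
  ... | yes e | _ = no λ { (p All.∷ _) → p e }
  ... | no ne | yes ps = yes (ne All.∷ ps)
  ... | no _ | no nps = no λ { (_ All.∷ ps) → nps ps }

InU? : (q m k h ℓ : ℕ) → (U : Matrix q m k) → Dec (InU q m k h ℓ U)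
InU? q m k h ℓ U with wt U ≟ h | rwt U ≟ ℓ | all? U
... | yes a | yes b | yes c = yes (a Data.Product., b Data.Product., c)
... | no na | _ | _ = no λ x → na (Data.Product.proj₁ x)
... | yes _ | no nb | _ = no λ x → nb (Data.Product.proj₁ (Data.Product.proj₂ x))
... | yes _ | yes _ | no nc = no λ x → nc (Data.Product.proj₂ (Data.Product.proj₂ x))

allVecs : ∀ {A : Set} → List A → (n : ℕ) → List (Vec A n)
allVecs xs zero = [ [] ]
allVecs xs (suc n) = concatMap (λ x → map (x ∷_) (allVecs xs n)) xs

-- enumeration of all of Z_q^{m×k}, each matrix exactly once
allMatrices : (q m k : ℕ) → List (Matrix q m k)
allMatrices q m k = allVecs (allVecs (allFin q) k) m

cardU : (q m k h ℓ : ℕ) → ℕ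
cardU q m k h ℓ = length (filter (InU? q m k h ℓ) (allMatrices q m k))

{-# OPTIONS --safe #-}
-- Neither ℓ < h nor the condition that no row has exactly one nonzero entry is needed: already
-- the matrices with exactly ℓ nonzero rows number at most C(m,ℓ) Q^ℓ, where Q = q^k is the
-- number of rows.  Counting the vectors over an alphabet by their number of entries outside a
-- set Z containing at most one letter obeys Pascal's rule, which gives this bound for matrices
-- (Z = {zero row}) and, with ℓ = 0, the fact that there is only one zero row (Z = {0}).
-- Finally C(m,ℓ) ℓ^ℓ ≤ (4m)^ℓ, because C(m,ℓ) ℓ! ≤ m^ℓ and ℓ^ℓ ≤ 4^ℓ ℓ!; the latter multiplies
-- the bounds (1 + 1/n)^n ≤ 4, each of which is Bernoulli's inequality applied to the two halves
-- of the exponent.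
module Submission where

open import Defs
open import Data.Nat using (ℕ; _*_; _^_; _≤_; _<_)
open import Data.Product using (Σ; _×_)

import Algebra.Properties.CommutativeSemigroup as CommSemigroupProperties
open import Data.Fin as Fin using (Fin; toℕ)
open import Data.List using (List; []; _∷_; _++_; map; concatMap; filter; length; allFin)
open import Data.List.Properties
  using (filter-++; length-++; length-filter; filter-none; length-map; length-tabulate)
open import Data.List.Relation.Binary.Sublist.Propositional using (⊆-refl)
open import Data.List.Relation.Binary.Sublist.Propositional.Properties using (filter⁺; length-mono-≤)
open import Data.List.Relation.Unary.All using (All; universal)
open import Data.List.Relation.Unary.All.Properties using (tabulate⁺)
open import Data.Nat using (zero; suc; _+_; _≟_; _!; z≤n; s≤s; ⌊_/2⌋; ⌈_/2⌉; >-nonZero)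
open import Data.Nat.Combinatorics using (_C_; nCk+nC[k+1]≡[n+1]C[k+1])
open import Data.Nat.ListAction using (sum)
open import Data.Nat.Properties
open import Data.Nat.Tactic.RingSolver using (solve-∀)
open import Data.Product using (_,_; proj₁; proj₂)
open import Data.Vec using (Vec; []; _∷_)
open import Function using (_∘_; id)
open import Level using (0ℓ)
open import Relation.Nullary using (yes; no; ¬_; ¬?; contradiction)
open import Relation.Unary using (Pred; Decidable; _⊆_; ∁)
open import Relation.Binary.PropositionalEquality using (_≡_; refl; sym; trans; cong; cong₂)

open CommSemigroupProperties +-commutativeSemigroup
  using () renaming (x∙yz≈y∙xz to m+[n+o]≡n+[m+o])
open CommSemigroupProperties *-commutativeSemigroup
  using () renaming (x∙yz≈y∙xz to m*[n*o]≡n*[m*o])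

count : {A : Set} {P : Pred A 0ℓ} → Decidable P → List A → ℕ
count P? xs = length (filter P? xs)

count-mono : {A : Set} {P Q : Pred A 0ℓ} (P? : Decidable P) (Q? : Decidable Q) →
             P ⊆ Q → ∀ xs → count P? xs ≤ count Q? xs
count-mono P? Q? P⊆Q xs = length-mono-≤ (filter⁺ P? Q? (λ { refl → P⊆Q }) (⊆-refl {x = xs}))

count-none : {A : Set} {P : Pred A 0ℓ} (P? : Decidable P) → ∀ {xs} → All (∁ P) xs → count P? xs ≡ 0
count-none P? ¬Ps = cong length (filter-none P? ¬Ps)

count-++ : {A : Set} {P : Pred A 0ℓ} (P? : Decidable P) →
           ∀ xs ys → count P? (xs ++ ys) ≡ count P? xs + count P? ys
count-++ P? xs ys = trans (cong length (filter-++ P? xs ys)) (length-++ (filter P? xs))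

count-map : {A B : Set} {P : Pred A 0ℓ} (P? : Decidable P) (f : B → A) →
            ∀ xs → count P? (map f xs) ≡ count (P? ∘ f) xs
count-map P? f [] = refl
count-map P? f (x ∷ xs) with P? (f x)
... | yes _ = cong suc (count-map P? f xs)
... | no _  = count-map P? f xs

count-concatMap : {A B : Set} {P : Pred A 0ℓ} (P? : Decidable P) (f : B → List A) →
                  ∀ xs → count P? (concatMap f xs) ≡ sum (map (count P? ∘ f) xs)
count-concatMap P? f [] = refl
count-concatMap P? f (x ∷ xs) =
  trans (count-++ P? (f x) (concatMap f xs)) (cong (count P? (f x) +_) (count-concatMap P? f xs))

sum-map-≤ : {A : Set} {P : Pred A 0ℓ} (P? : Decidable P) {f : A → ℕ} {a b : ℕ} →
            (∀ {x} → P x → f x ≤ a) → (∀ {x} → ¬ P x → f x ≤ b) →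
            ∀ xs → sum (map f xs) ≤ count P? xs * a + count (¬? ∘ P?) xs * b
sum-map-≤ P? fP≤a f¬P≤b [] = z≤n
sum-map-≤ P? {f} {a} {b} fP≤a f¬P≤b (x ∷ xs) with P? x
... | yes p = begin
  f x + sum (map f xs)                            ≤⟨ +-mono-≤ (fP≤a p) (sum-map-≤ P? fP≤a f¬P≤b xs) ⟩
  a + (count P? xs * a + count (¬? ∘ P?) xs * b)  ≡⟨ +-assoc a _ _ ⟨
  a + count P? xs * a + count (¬? ∘ P?) xs * b    ∎
  where open ≤-Reasoning
... | no ¬p = begin
  f x + sum (map f xs)                            ≤⟨ +-mono-≤ (f¬P≤b ¬p) (sum-map-≤ P? fP≤a f¬P≤b xs) ⟩
  b + (count P? xs * a + count (¬? ∘ P?) xs * b)  ≡⟨ m+[n+o]≡n+[m+o] b (count P? xs * a) _ ⟩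
  count P? xs * a + (b + count (¬? ∘ P?) xs * b)  ∎
  where open ≤-Reasoning

length-concatMap-∷ : ∀ {A : Set} {n} (xs : List A) (vs : List (Vec A n)) →
                     length (concatMap (λ x → map (x ∷_) vs) xs) ≡ length xs * length vs
length-concatMap-∷ [] vs = refl
length-concatMap-∷ (x ∷ xs) vs =
  trans (length-++ (map (x ∷_) vs)) (cong₂ _+_ (length-map (x ∷_) vs) (length-concatMap-∷ xs vs))

length-allVecs : {A : Set} (xs : List A) → ∀ n → length (allVecs xs n) ≡ length xs ^ n
length-allVecs xs zero = refl
length-allVecs xs (suc n) =
  trans (length-concatMap-∷ xs (allVecs xs n)) (cong (length xs *_) (length-allVecs xs n))

module _ {A : Set} {Z : Pred A 0ℓ} (Z? : Decidable Z) where

  weight : ∀ {n} → Vec A n → ℕ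
  weight [] = 0
  weight (x ∷ v) with Z? x
  ... | yes _ = weight v
  ... | no _  = suc (weight v)

  hasWeight? : ∀ {n} ℓ → Decidable (λ (v : Vec A n) → weight v ≡ ℓ)
  hasWeight? ℓ v = weight v ≟ ℓ

  weight-∷-∈ : ∀ {n x} (v : Vec A n) → Z x → weight (x ∷ v) ≡ weight v
  weight-∷-∈ {x = x} v z with Z? x
  ... | yes _ = refl
  ... | no ¬z = contradiction z ¬z

  weight-∷-∉ : ∀ {n x} (v : Vec A n) → ¬ Z x → weight (x ∷ v) ≡ suc (weight v)
  weight-∷-∉ {x = x} v ¬z with Z? x
  ... | yes z = contradiction z ¬z
  ... | no _  = refl

  count-weight-∷-∈ : ∀ {n x} ℓ → Z x → (vs : List (Vec A n)) →
                     count (hasWeight? ℓ) (map (x ∷_) vs) ≤ count (hasWeight? ℓ) vs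
  count-weight-∷-∈ {x = x} ℓ z vs = begin
    count (hasWeight? ℓ) (map (x ∷_) vs)
      ≡⟨ count-map (hasWeight? ℓ) (x ∷_) vs ⟩
    count (hasWeight? ℓ ∘ (x ∷_)) vs
      ≤⟨ count-mono _ (hasWeight? ℓ) (λ {v} → trans (sym (weight-∷-∈ v z))) vs ⟩
    count (hasWeight? ℓ) vs ∎
    where open ≤-Reasoning

  count-weight-∷-∉ : ∀ {n x} ℓ → ¬ Z x → (vs : List (Vec A n)) →
                     count (hasWeight? (suc ℓ)) (map (x ∷_) vs) ≤ count (hasWeight? ℓ) vs
  count-weight-∷-∉ {x = x} ℓ ¬z vs = begin
    count (hasWeight? (suc ℓ)) (map (x ∷_) vs)
      ≡⟨ count-map (hasWeight? (suc ℓ)) (x ∷_) vs ⟩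
    count (hasWeight? (suc ℓ) ∘ (x ∷_)) vs
      ≤⟨ count-mono _ (hasWeight? ℓ) (λ {v} → suc-injective ∘ trans (sym (weight-∷-∉ v ¬z))) vs ⟩
    count (hasWeight? ℓ) vs ∎
    where open ≤-Reasoning

  count-weight-zero-∷-∉ : ∀ {n x} → ¬ Z x → (vs : List (Vec A n)) →
                          count (hasWeight? 0) (map (x ∷_) vs) ≡ 0
  count-weight-zero-∷-∉ {x = x} ¬z vs = trans (count-map (hasWeight? 0) (x ∷_) vs)
    (count-none (hasWeight? 0 ∘ (x ∷_)) (universal (λ v → 1+n≢0 ∘ trans (sym (weight-∷-∉ v ¬z))) vs))

  count-weight-allVecs-suc≤ : (xs : List A) → ∀ n ℓ {a b} →
    count (hasWeight? ℓ) (allVecs xs n) ≤ a →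
    (∀ {x} → ¬ Z x → count (hasWeight? ℓ) (map (x ∷_) (allVecs xs n)) ≤ b) →
    count (hasWeight? ℓ) (allVecs xs (suc n)) ≤ count Z? xs * a + count (¬? ∘ Z?) xs * b
  count-weight-allVecs-suc≤ xs n ℓ {a} {b} ≤a ∉⇒≤b = begin
    count (hasWeight? ℓ) (allVecs xs (suc n))
      ≡⟨ count-concatMap (hasWeight? ℓ) (λ x → map (x ∷_) (allVecs xs n)) xs ⟩
    sum (map (λ x → count (hasWeight? ℓ) (map (x ∷_) (allVecs xs n))) xs)
      ≤⟨ sum-map-≤ Z? (λ z → ≤-trans (count-weight-∷-∈ ℓ z (allVecs xs n)) ≤a) ∉⇒≤b xs ⟩
    count Z? xs * a + count (¬? ∘ Z?) xs * b ∎
    where open ≤-Reasoning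

  count-weight-allVecs≤ : (xs : List A) → count Z? xs ≤ 1 →
                          ∀ n ℓ → count (hasWeight? ℓ) (allVecs xs n) ≤ (n C ℓ) * length xs ^ ℓ
  count-weight-allVecs≤ xs Z≤1 zero zero = ≤-refl
  count-weight-allVecs≤ xs Z≤1 zero (suc ℓ) = z≤n
  count-weight-allVecs≤ xs Z≤1 (suc n) zero = begin
    count (hasWeight? 0) (allVecs xs (suc n))
      ≤⟨ count-weight-allVecs-suc≤ xs n 0 (count-weight-allVecs≤ xs Z≤1 n 0)
           (λ ¬z → ≤-reflexive (count-weight-zero-∷-∉ ¬z (allVecs xs n))) ⟩
    count Z? xs * 1 + count (¬? ∘ Z?) xs * 0
      ≡⟨ cong₂ _+_ (*-identityʳ (count Z? xs)) (*-zeroʳ (count (¬? ∘ Z?) xs)) ⟩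
    count Z? xs + 0
      ≤⟨ +-monoˡ-≤ 0 Z≤1 ⟩
    1 ∎
    where open ≤-Reasoning
  count-weight-allVecs≤ xs Z≤1 (suc n) (suc ℓ) = begin
    count (hasWeight? (suc ℓ)) (allVecs xs (suc n))
      ≤⟨ count-weight-allVecs-suc≤ xs n (suc ℓ) (count-weight-allVecs≤ xs Z≤1 n (suc ℓ))
           (λ ¬z → ≤-trans (count-weight-∷-∉ ℓ ¬z (allVecs xs n)) (count-weight-allVecs≤ xs Z≤1 n ℓ)) ⟩
    count Z? xs * ((n C suc ℓ) * L ^ suc ℓ) + count (¬? ∘ Z?) xs * ((n C ℓ) * L ^ ℓ)
      ≤⟨ +-mono-≤ (*-monoˡ-≤ _ Z≤1) (*-monoˡ-≤ _ (length-filter (¬? ∘ Z?) xs)) ⟩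
    1 * ((n C suc ℓ) * L ^ suc ℓ) + L * ((n C ℓ) * L ^ ℓ)
      ≡⟨ regroup (n C suc ℓ) (n C ℓ) L (L ^ ℓ) ⟩
    (n C ℓ + n C suc ℓ) * L ^ suc ℓ
      ≡⟨ cong (_* L ^ suc ℓ) (nCk+nC[k+1]≡[n+1]C[k+1] n ℓ) ⟩
    (suc n C suc ℓ) * L ^ suc ℓ ∎
    where
      open ≤-Reasoning
      L = length xs
      regroup : ∀ c c′ l p → 1 * (c * (l * p)) + l * (c′ * p) ≡ (c′ + c) * (l * p)
      regroup = solve-∀

^-distribʳ-* : ∀ m n o → (m * n) ^ o ≡ m ^ o * n ^ o
^-distribʳ-* m n zero = refl
^-distribʳ-* m n (suc o) = trans (cong (m * n *_) (^-distribʳ-* m n o)) (swap m n (m ^ o) (n ^ o))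
  where swap : ∀ a b c d → a * b * (c * d) ≡ a * c * (b * d)
        swap = solve-∀

m^[1+n]+[1+n]*m^n≤[1+m]^[1+n] : ∀ m n → m ^ suc n + suc n * m ^ n ≤ suc m ^ suc n
m^[1+n]+[1+n]*m^n≤[1+m]^[1+n] m zero = ≤-reflexive (+-comm (m * 1) 1)
m^[1+n]+[1+n]*m^n≤[1+m]^[1+n] m (suc n) = begin
    m ^ suc (suc n) + suc (suc n) * m ^ suc n
      ≤⟨ m≤m+n _ (suc n * m ^ n) ⟩
    m ^ suc (suc n) + suc (suc n) * m ^ suc n + suc n * m ^ n
      ≡⟨ factor m n (m ^ n) ⟩
    suc m * (m ^ suc n + suc n * m ^ n)
      ≤⟨ *-monoʳ-≤ (suc m) (m^[1+n]+[1+n]*m^n≤[1+m]^[1+n] m n) ⟩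
    suc m ^ suc (suc n) ∎
  where open ≤-Reasoning
        factor : ∀ m n p → m * (m * p) + (2 + n) * (m * p) + (1 + n) * p ≡
                           (1 + m) * (m * p + (1 + n) * p)
        factor = solve-∀

nCk*k!≤n^k : ∀ n k → (n C k) * k ! ≤ n ^ k
nCk*k!≤n^k n zero = ≤-refl
nCk*k!≤n^k zero (suc k) = z≤n
nCk*k!≤n^k (suc n) (suc k) = begin
    (suc n C suc k) * (suc k * k !)
      ≡⟨ cong (_* (suc k * k !)) (sym (nCk+nC[k+1]≡[n+1]C[k+1] n k)) ⟩
    (n C k + n C suc k) * (suc k * k !)
      ≡⟨ distrib (n C k) (n C suc k) k (k !) ⟩
    suc k * ((n C k) * k !) + (n C suc k) * (suc k * k !)
      ≤⟨ +-mono-≤ (*-monoʳ-≤ (suc k) (nCk*k!≤n^k n k)) (nCk*k!≤n^k n (suc k)) ⟩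
    suc k * n ^ k + n ^ suc k
      ≡⟨ +-comm (suc k * n ^ k) _ ⟩
    n ^ suc k + suc k * n ^ k
      ≤⟨ m^[1+n]+[1+n]*m^n≤[1+m]^[1+n] n k ⟩
    suc n ^ suc k ∎
  where open ≤-Reasoning
        distrib : ∀ c c′ k f → (c + c′) * ((1 + k) * f) ≡ (1 + k) * (c * f) + c′ * ((1 + k) * f)
        distrib = solve-∀

-- Bernoulli's inequality (1 - 1/(n+1))^j ≥ 1 - j/(n+1), cleared of denominators.
[1+n]^[1+j]≤[1+n]*n^j+j*[1+n]^j : ∀ n j → suc n ^ suc j ≤ suc n * n ^ j + j * suc n ^ j
[1+n]^[1+j]≤[1+n]*n^j+j*[1+n]^j n zero = ≤-reflexive (sym (+-identityʳ (suc n * 1)))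
[1+n]^[1+j]≤[1+n]*n^j+j*[1+n]^j n (suc j) = begin
    N * N ^ suc j
      ≤⟨ *-monoʳ-≤ N ([1+n]^[1+j]≤[1+n]*n^j+j*[1+n]^j n j) ⟩
    N * (N * n ^ j + j * N ^ j)
      ≡⟨ expand n (n ^ j) (N ^ j) j ⟩
    N * (n * n ^ j) + N * n ^ j + j * (N * N ^ j)
      ≤⟨ +-monoˡ-≤ _ (+-monoʳ-≤ (N * (n * n ^ j)) (*-monoʳ-≤ N (^-monoˡ-≤ j (n≤1+n n)))) ⟩
    N * (n * n ^ j) + N * N ^ j + j * (N * N ^ j)
      ≡⟨ +-assoc (N * (n * n ^ j)) _ _ ⟩
    N * n ^ suc j + suc j * N ^ suc j ∎
  where open ≤-Reasoning
        N = suc n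
        expand : ∀ n a b j → (1 + n) * ((1 + n) * a + j * b) ≡
                             (1 + n) * (n * a) + (1 + n) * a + j * ((1 + n) * b)
        expand = solve-∀

2*j≤1+n⇒[1+n]^j≤2*n^j : ∀ n j → 2 * j ≤ suc n → suc n ^ j ≤ 2 * n ^ j
2*j≤1+n⇒[1+n]^j≤2*n^j n j 2j≤N = *-cancelˡ-≤ N (+-cancelʳ-≤ (N * N ^ j) _ _ (begin
    N * N ^ j + N * N ^ j
      ≡⟨ double N (N ^ j) ⟩
    2 * N ^ suc j
      ≤⟨ *-monoʳ-≤ 2 ([1+n]^[1+j]≤[1+n]*n^j+j*[1+n]^j n j) ⟩
    2 * (N * n ^ j + j * N ^ j)
      ≡⟨ expand N (n ^ j) j (N ^ j) ⟩
    N * (2 * n ^ j) + 2 * j * N ^ j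
      ≤⟨ +-monoʳ-≤ (N * (2 * n ^ j)) (*-monoˡ-≤ (N ^ j) 2j≤N) ⟩
    N * (2 * n ^ j) + N * N ^ j ∎))
  where open ≤-Reasoning
        N = suc n
        double : ∀ a b → a * b + a * b ≡ 2 * (a * b)
        double = solve-∀
        expand : ∀ a b j c → 2 * (a * b + j * c) ≡ a * (2 * b) + 2 * j * c
        expand = solve-∀

2*⌊n/2⌋≤n : ∀ n → 2 * ⌊ n /2⌋ ≤ n
2*⌊n/2⌋≤n n = begin
    2 * ⌊ n /2⌋          ≡⟨ cong (⌊ n /2⌋ +_) (+-identityʳ ⌊ n /2⌋) ⟩
    ⌊ n /2⌋ + ⌊ n /2⌋    ≤⟨ +-monoʳ-≤ ⌊ n /2⌋ (⌊n/2⌋≤⌈n/2⌉ n) ⟩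
    ⌊ n /2⌋ + ⌈ n /2⌉    ≡⟨ ⌊n/2⌋+⌈n/2⌉≡n n ⟩
    n ∎
  where open ≤-Reasoning

[1+n]^n≤4*n^n : ∀ n → suc n ^ n ≤ 4 * n ^ n
[1+n]^n≤4*n^n n = begin
    suc n ^ n                         ≡⟨ cong (suc n ^_) (⌊n/2⌋+⌈n/2⌉≡n n) ⟨
    suc n ^ (a + b)                   ≡⟨ ^-distribˡ-+-* (suc n) a b ⟩
    suc n ^ a * suc n ^ b             ≤⟨ *-mono-≤ (2*j≤1+n⇒[1+n]^j≤2*n^j n a 2a≤1+n)
                                                    (2*j≤1+n⇒[1+n]^j≤2*n^j n b 2b≤1+n) ⟩
    (2 * n ^ a) * (2 * n ^ b)         ≡⟨ regroup (n ^ a) (n ^ b) ⟩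
    4 * (n ^ a * n ^ b)               ≡⟨ cong (4 *_) (^-distribˡ-+-* n a b) ⟨
    4 * n ^ (a + b)                   ≡⟨ cong (λ i → 4 * n ^ i) (⌊n/2⌋+⌈n/2⌉≡n n) ⟩
    4 * n ^ n ∎
  where open ≤-Reasoning
        a = ⌊ n /2⌋
        b = ⌈ n /2⌉
        2a≤1+n : 2 * a ≤ suc n
        2a≤1+n = m≤n⇒m≤1+n (2*⌊n/2⌋≤n n)
        2b≤1+n : 2 * b ≤ suc n
        2b≤1+n = 2*⌊n/2⌋≤n (suc n)
        regroup : ∀ x y → (2 * x) * (2 * y) ≡ 4 * (x * y)
        regroup = solve-∀

n^n≤4^n*n! : ∀ n → n ^ n ≤ 4 ^ n * n !
n^n≤4^n*n! zero = ≤-refl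
n^n≤4^n*n! (suc n) = begin
    suc n * suc n ^ n           ≤⟨ *-monoʳ-≤ (suc n) ([1+n]^n≤4*n^n n) ⟩
    suc n * (4 * n ^ n)         ≤⟨ *-monoʳ-≤ (suc n) (*-monoʳ-≤ 4 (n^n≤4^n*n! n)) ⟩
    suc n * (4 * (4 ^ n * n !)) ≡⟨ regroup (suc n) (4 ^ n) (n !) ⟩
    4 * 4 ^ n * (suc n * n !) ∎
  where open ≤-Reasoning
        regroup : ∀ a b c → a * (4 * (b * c)) ≡ 4 * b * (a * c)
        regroup = solve-∀

nCk*k^k≤[4*n]^k : ∀ n k → (n C k) * k ^ k ≤ (4 * n) ^ k
nCk*k^k≤[4*n]^k n k = begin
    (n C k) * k ^ k           ≤⟨ *-monoʳ-≤ (n C k) (n^n≤4^n*n! k) ⟩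
    (n C k) * (4 ^ k * k !)   ≡⟨ m*[n*o]≡n*[m*o] (n C k) (4 ^ k) (k !) ⟩
    4 ^ k * ((n C k) * k !)   ≤⟨ *-monoʳ-≤ (4 ^ k) (nCk*k!≤n^k n k) ⟩
    4 ^ k * n ^ k             ≡⟨ ^-distribʳ-* 4 n k ⟨
    (4 * n) ^ k ∎
  where open ≤-Reasoning

isZero? : ∀ {q} → Decidable (λ (x : Fin q) → toℕ x ≡ 0)
isZero? x = toℕ x ≟ 0

isZeroRow? : ∀ {q k} → Decidable (λ (r : Vec (Fin q) k) → nz r ≡ 0)
isZeroRow? r = nz r ≟ 0

nz≡weight : ∀ {q k} (r : Vec (Fin q) k) → nz r ≡ weight isZero? r
nz≡weight [] = refl
nz≡weight (x ∷ r) with toℕ x ≟ 0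
... | yes _ = nz≡weight r
... | no _  = cong suc (nz≡weight r)

rwt≡weight : ∀ {q m k} (U : Matrix q m k) → rwt U ≡ weight isZeroRow? U
rwt≡weight [] = refl
rwt≡weight (r ∷ U) with nz r ≟ 0
... | yes _ = rwt≡weight U
... | no _  = cong suc (rwt≡weight U)

count-isZero-allFin≤1 : ∀ q → count isZero? (allFin q) ≤ 1
count-isZero-allFin≤1 zero = z≤n
count-isZero-allFin≤1 (suc q) =
  s≤s (≤-reflexive (count-none isZero? (tabulate⁺ {n = q} {f = Fin.suc} (λ _ ()))))

count-isZeroRow≤1 : ∀ q k → count isZeroRow? (allVecs (allFin q) k) ≤ 1
count-isZeroRow≤1 q k = ≤-trans
  (count-mono isZeroRow? (hasWeight? isZero? 0) (λ {r} → trans (sym (nz≡weight r)))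
              (allVecs (allFin q) k))
  (count-weight-allVecs≤ isZero? (allFin q) (count-isZero-allFin≤1 q) k 0)

count-rwt≤ : ∀ q m k ℓ → count (λ U → rwt U ≟ ℓ) (allMatrices q m k) ≤ (m C ℓ) * (q ^ k) ^ ℓ
count-rwt≤ q m k ℓ = begin
  count (λ U → rwt U ≟ ℓ) (allVecs rows m)
    ≤⟨ count-mono (λ U → rwt U ≟ ℓ) (hasWeight? isZeroRow? ℓ) (λ {U} → trans (sym (rwt≡weight U)))
                  (allVecs rows m) ⟩
  count (hasWeight? isZeroRow? ℓ) (allVecs rows m)
    ≤⟨ count-weight-allVecs≤ isZeroRow? rows (count-isZeroRow≤1 q k) m ℓ ⟩
  (m C ℓ) * length rows ^ ℓ
    ≡⟨ cong (λ Q → (m C ℓ) * Q ^ ℓ)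
            (trans (length-allVecs (allFin q) k) (cong (_^ k) (length-tabulate id))) ⟩
  (m C ℓ) * (q ^ k) ^ ℓ ∎
  where open ≤-Reasoning
        rows = allVecs (allFin q) k

cardU≤count-rwt : ∀ q m k h ℓ → cardU q m k h ℓ ≤ count (λ U → rwt U ≟ ℓ) (allMatrices q m k)
cardU≤count-rwt q m k h ℓ =
  count-mono (InU? q m k h ℓ) (λ U → rwt U ≟ ℓ) (proj₁ ∘ proj₂) (allMatrices q m k)

lemma6p11 : (q k : ℕ) → 1 ≤ q →
    Σ ℕ (λ ζ → 1 ≤ ζ × ((m h ℓ : ℕ) → ℓ < h →
      cardU q m k h ℓ * ℓ ^ ℓ ≤ (ζ * m) ^ ℓ))
lemma6p11 q k 1≤q = 4 * q ^ k , *-mono-≤ {1} {4} (s≤s z≤n) (m^n>0 q {{>-nonZero 1≤q}} k) , bound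
  where
    bound : (m h ℓ : ℕ) → ℓ < h → cardU q m k h ℓ * ℓ ^ ℓ ≤ (4 * q ^ k * m) ^ ℓ
    bound m h ℓ _ = begin
      cardU q m k h ℓ * ℓ ^ ℓ
        ≤⟨ *-monoˡ-≤ (ℓ ^ ℓ) (≤-trans (cardU≤count-rwt q m k h ℓ) (count-rwt≤ q m k ℓ)) ⟩
      (m C ℓ) * (q ^ k) ^ ℓ * ℓ ^ ℓ
        ≡⟨ swap (m C ℓ) ((q ^ k) ^ ℓ) (ℓ ^ ℓ) ⟩
      (q ^ k) ^ ℓ * ((m C ℓ) * ℓ ^ ℓ)
        ≤⟨ *-monoʳ-≤ ((q ^ k) ^ ℓ) (nCk*k^k≤[4*n]^k m ℓ) ⟩
      (q ^ k) ^ ℓ * (4 * m) ^ ℓ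
        ≡⟨ ^-distribʳ-* (q ^ k) (4 * m) ℓ ⟨
      (q ^ k * (4 * m)) ^ ℓ
        ≡⟨ cong (_^ ℓ) (reassoc (q ^ k) m) ⟩
      (4 * q ^ k * m) ^ ℓ ∎
      where
        open ≤-Reasoning
        swap : ∀ a b c → a * b * c ≡ b * (a * c)
        swap = solve-∀
        reassoc : ∀ a m → a * (4 * m) ≡ 4 * a * m
        reassoc = solve-∀
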